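{- Let $G$ be a finite simple graph. Then $G$ admits an FD-code if and only if $G$ is twin-free; and $G$ admits an FTD-code if and only if $G$ is twin-free and has no isolated vertex.
   Context: For a vertex $v$ of $G=(V,E)$, $N(v)$ denotes its open and $N[v]=N(v)\cup\{v\}$ its closed neighborhood. A set $C\subseteq V$ is full-separating if for every pair of distinct vertices $u,v$ we have $(N(v)\cap C)\setminus\{u\}\neq(N(u)\cap C)\setminus\{v\}$. $C$ is dominating if $N[v]\cap C\neq\emptyset$ for all $v\in V$, and total-dominating if $N(v)\cap C\neq\emptyset$ for all $v\in V$. An FD-code (full-separating-dominating code) is a full-separating dominating set; an FTD-code (full-separating-total-dominating code) is a full-separating total-dominating set. Closed twins are adjacent vertices $u,v$ with $N[u]=N[v]$; open twins are distinct non-adjacent vertices $u,v$ with $N(u)=N(v)$. A graph is twin-free if it has neither closed nor open twins. An isolated vertex is a vertex $v$ with $N(v)=\emptyset$. -}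

module Defs where

open import Data.Nat using (ℕ)
open import Data.Fin using (Fin)
open import Data.Fin.Subset using (Subset; _∈_)
open import Data.Product using (Σ; ∃; _×_)
open import Data.Sum using (_⊎_)
open import Relation.Nullary using (¬_; Dec)
open import Relation.Binary.PropositionalEquality using (_≡_; _≢_)
open import Function.Bundles using (_⇔_)
open import Level using (0ℓ)

record Graph (n : ℕ) : Set₁ where
  field
    Adj     : Fin n → Fin n → Set
    Adj?    : ∀ u v → Dec (Adj u v)
    sym     : ∀ {u v} → Adj u v → Adj v u
    irrefl  : ∀ {v} → ¬ Adj v v

module _ {n : ℕ} (G : Graph n) where
  open Graph G

  InN : Fin n → Fin n → Set
  InN v w = Adj v w

  InN[] : Fin n → Fin n → Set
  InN[] v w = Adj v w ⊎ (w ≡ v)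

  FullSeparating : Subset n → Set
  FullSeparating C = ∀ u v → u ≢ v →
    ¬ (∀ w → ((InN v w × w ∈ C × w ≢ u) ⇔ (InN u w × w ∈ C × w ≢ v)))

  Dominating : Subset n → Set
  Dominating C = ∀ v → ∃ λ w → InN[] v w × w ∈ C

  TotalDominating : Subset n → Set
  TotalDominating C = ∀ v → ∃ λ w → InN v w × w ∈ C

  FDCode : Subset n → Set
  FDCode C = FullSeparating C × Dominating C

  FTDCode : Subset n → Set
  FTDCode C = FullSeparating C × TotalDominating C

  ClosedTwins : Fin n → Fin n → Set
  ClosedTwins u v = Adj u v × (∀ w → InN[] u w ⇔ InN[] v w)

  OpenTwins : Fin n → Fin n → Set
  OpenTwins u v = u ≢ v × ¬ Adj u v × (∀ w → InN u w ⇔ InN v w)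

  TwinFree : Set
  TwinFree = ∀ u v → ¬ ClosedTwins u v × ¬ OpenTwins u v

  Isolated : Fin n → Set
  Isolated v = ∀ w → ¬ InN v w

  NoIsolated : Set
  NoIsolated = ∀ v → ¬ Isolated v

-- Two distinct vertices u, v fail to be separated by the whole vertex set
-- exactly when N(v) ∖ {u} ⊆ N(u) and N(u) ∖ {v} ⊆ N(v), i.e. when they are
-- closed twins (if adjacent) or open twins (if not); and such a pair is
-- separated by no set C at all. Hence V is an FD-code of a twin-free graph,
-- and an FTD-code once no vertex is isolated.
module Submission where

open import Defs
open import Data.Nat using (ℕ)
open import Data.Fin using (Fin; _≟_)
open import Data.Fin.Subset using (Subset; ⊤; _∈_)
open import Data.Fin.Subset.Properties using (∈⊤)
open import Data.Fin.Properties using (any?)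
open import Data.Product using (∃; _×_; _,_; proj₁; proj₂)
open import Data.Sum using (_⊎_; inj₁; inj₂)
open import Data.Empty using (⊥; ⊥-elim)
open import Relation.Nullary using (¬_; yes; no)
open import Relation.Binary.PropositionalEquality using (_≢_; refl)
open import Function.Bundles using (_⇔_; mk⇔; Equivalence)
open Equivalence using (to; from)

module _ {n : ℕ} (G : Graph n) where
  open Graph G renaming (sym to Adj-sym)

  _≲_ : Fin n → Fin n → Set
  v ≲ u = ∀ w → Adj v w → w ≢ u → Adj u w

  Trace : Subset n → Fin n → Fin n → Fin n → Set
  Trace C u v w = InN G v w × w ∈ C × w ≢ u

  Unseparated : Subset n → Fin n → Fin n → Set
  Unseparated C u v = ∀ w → Trace C u v w ⇔ Trace C v u w

  ≲⇒Trace⊆ : ∀ {C u v w} → v ≲ u → Trace C u v w → Trace C v u w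
  ≲⇒Trace⊆ v≲u (vw , w∈C , w≢u) = v≲u _ vw w≢u , w∈C , λ { refl → irrefl vw }

  ≲⇒unseparated : ∀ {C u v} → v ≲ u → u ≲ v → Unseparated C u v
  ≲⇒unseparated v≲u u≲v w = mk⇔ (≲⇒Trace⊆ v≲u) (≲⇒Trace⊆ u≲v)

  unseparated-⊤⇒≲ : ∀ {u v} → Unseparated ⊤ u v → v ≲ u × u ≲ v
  unseparated-⊤⇒≲ unsep =
      (λ w vw w≢u → proj₁ (to (unsep w) (vw , ∈⊤ , w≢u)))
    , (λ w uw w≢v → proj₁ (from (unsep w) (uw , ∈⊤ , w≢v)))

  ⊆N[]⇒≲ : ∀ {u v} → (∀ w → InN[] G v w → InN[] G u w) → v ≲ u
  ⊆N[]⇒≲ N[v]⊆N[u] w vw w≢u with N[v]⊆N[u] w (inj₁ vw)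
  ... | inj₁ uw   = uw
  ... | inj₂ w≡u  = ⊥-elim (w≢u w≡u)

  ≲⇒⊆N[] : ∀ {u v} → Adj u v → u ≲ v → ∀ w → InN[] G u w → InN[] G v w
  ≲⇒⊆N[] uv u≲v w (inj₂ refl) = inj₁ (Adj-sym uv)
  ≲⇒⊆N[] {v = v} uv u≲v w (inj₁ uw) with w ≟ v
  ... | yes w≡v = inj₂ w≡v
  ... | no w≢v  = inj₁ (u≲v w uw w≢v)

  ≲⇒⊆N : ∀ {u v} → ¬ Adj u v → u ≲ v → ∀ w → InN G u w → InN G v w
  ≲⇒⊆N ¬uv u≲v w uw = u≲v w uw λ { refl → ¬uv uw }

  closedTwins⇒≲ : ∀ {u v} → ClosedTwins G u v → v ≲ u × u ≲ v
  closedTwins⇒≲ (_ , N[u]⇔N[v]) =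
    ⊆N[]⇒≲ (λ w → from (N[u]⇔N[v] w)) , ⊆N[]⇒≲ (λ w → to (N[u]⇔N[v] w))

  openTwins⇒≲ : ∀ {u v} → OpenTwins G u v → v ≲ u × u ≲ v
  openTwins⇒≲ (_ , _ , N[u]⇔N[v]) =
    (λ w vw _ → from (N[u]⇔N[v] w) vw) , (λ w uw _ → to (N[u]⇔N[v] w) uw)

  ≲⇒twins : ∀ {u v} → u ≢ v → v ≲ u → u ≲ v → ClosedTwins G u v ⊎ OpenTwins G u v
  ≲⇒twins {u} {v} u≢v v≲u u≲v with Adj? u v
  ... | yes uv = inj₁ (uv , λ w → mk⇔ (≲⇒⊆N[] uv u≲v w) (≲⇒⊆N[] (Adj-sym uv) v≲u w))
  ... | no ¬uv = inj₂ (u≢v , ¬uv , λ w →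
                   mk⇔ (≲⇒⊆N ¬uv u≲v w) (≲⇒⊆N (λ vu → ¬uv (Adj-sym vu)) v≲u w))

  twinFree-intro : (∀ u v → u ≢ v → v ≲ u → u ≲ v → ⊥) → TwinFree G
  twinFree-intro noPair u v =
      (λ ct@(uv , _) → let v≲u , u≲v = closedTwins⇒≲ ct in
                       noPair u v (λ { refl → irrefl uv }) v≲u u≲v)
    , (λ ot@(u≢v , _) → let v≲u , u≲v = openTwins⇒≲ ot in noPair u v u≢v v≲u u≲v)

  twinFree-elim : TwinFree G → ∀ {u v} → u ≢ v → v ≲ u → u ≲ v → ⊥
  twinFree-elim tf {u} {v} u≢v v≲u u≲v with ≲⇒twins u≢v v≲u u≲v
  ... | inj₁ ct = proj₁ (tf u v) ct
  ... | inj₂ ot = proj₂ (tf u v) ot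

  fullSeparating⇒twinFree : ∀ {C} → FullSeparating G C → TwinFree G
  fullSeparating⇒twinFree sep =
    twinFree-intro λ u v u≢v v≲u u≲v → sep u v u≢v (≲⇒unseparated v≲u u≲v)

  twinFree⇒fullSeparating-⊤ : TwinFree G → FullSeparating G ⊤
  twinFree⇒fullSeparating-⊤ tf u v u≢v unsep =
    let v≲u , u≲v = unseparated-⊤⇒≲ unsep in twinFree-elim tf u≢v v≲u u≲v

  ⊤-dominating : Dominating G ⊤
  ⊤-dominating v = v , inj₂ refl , ∈⊤

  noIsolated⇒⊤-totalDominating : NoIsolated G → TotalDominating G ⊤
  noIsolated⇒⊤-totalDominating noIso v with any? (Adj? v)
  ... | yes (w , vw) = w , vw , ∈⊤
  ... | no ¬∃w       = ⊥-elim (noIso v λ w vw → ¬∃w (w , vw))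

  totalDominating⇒noIsolated : ∀ {C} → TotalDominating G C → NoIsolated G
  totalDominating⇒noIsolated td v iso = let w , vw , _ = td v in iso w vw

corollary1 : ∀ (n : ℕ) (G : Graph n) →
    ((∃ λ (C : Subset n) → FDCode G C) ⇔ TwinFree G)
    × ((∃ λ (C : Subset n) → FTDCode G C) ⇔ (TwinFree G × NoIsolated G))
corollary1 n G =
    mk⇔ (λ (_ , sep , _) → fullSeparating⇒twinFree G sep)
        (λ tf → ⊤ , twinFree⇒fullSeparating-⊤ G tf , ⊤-dominating G)
  , mk⇔ (λ (_ , sep , td) → fullSeparating⇒twinFree G sep , totalDominating⇒noIsolated G td)
        (λ (tf , noIso) → ⊤ , twinFree⇒fullSeparating-⊤ G tf , noIsolated⇒⊤-totalDominating G noIso)
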